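{- Let $G$ be a tree with root $r$ and $p(r)=0$, consider an execution of the density-greedy algorithm for trees on $G$, and let $T_1,\dots,T_k$ be defined as in the context. Then for every rooted subtree $T$ of $G$ and every $j\in\{1,\dots,k\}$, $$p(T)\ \le\ \sum_{i=1}^{j-1}d(T_i)c(T_i)+d(T_j)\Bigl(c(T)-\sum_{i=1}^{j-1}c(T_i)\Bigr).$$
   Context: $G=(V,E)$ is a tree with edge costs $c(e)>0$, prizes $p(v)\ge0$, root $r$; $p(S)$, $c(S)$ denote total prize and cost of a subgraph $S$. Rooted subtree: subtree containing $r$; for rooted $T$ with an edge $d(T)=p(T)/c(T)$ (trivial tree: 0). A min-max subtree is an inclusion-wise minimal rooted subtree of maximum density. For a rooted subtree $\overline T$, $G/\overline T$ is obtained by contracting $\overline T$ into $r$ (root prize $0$, other prizes and costs unchanged); the extension of a subgraph of $G/\overline T$ is the subgraph of $G$ formed by the corresponding edges. For any subtree $S$ of $G$ with an edge, $r_S$ is its vertex closest to $r$, and $d(S)=d_G(S)=(p(S)-p(r_S))/c(S)$. Density-greedy algorithm for trees: $\pi=()$, $\overline T=(\{r\},\emptyset)$; while $G/\overline T$ has nonzero total prize: choose an arbitrary min-max subtree of $G/\overline T$, append to $\pi$ the edge of $G$ corresponding to its unique edge incident to $r$, add that edge to $\overline T$. Trees $T_1,\dots,T_k$: $t_1=1$; $T_i$ is the extension in $G$ of the min-max subtree chosen in iteration $t_i$, and $t_{i+1}=t_i+|E(T_i)|$, continued as long as $t_i$ does not exceed the number of iterations; $k$ is the number of trees obtained.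
   Formalization: The edge costs $c(e)$ and the prizes $p(v)$ are rational rather than real. -}

module Defs where

open import Data.Nat as ℕ using (ℕ; zero; suc; _∸_)
open import Data.Fin using (Fin; zero; suc)
open import Data.Bool using (Bool; true; false; if_then_else_; _∨_)
open import Data.List using (List; []; _∷_)
open import Data.Product using (Σ; _×_; _,_; ∃-syntax)
open import Data.Sum using (_⊎_)
open import Data.Rational using (ℚ; 0ℚ; _+_; _÷_; _≤_; ≢-nonZero)
open import Data.Rational.Properties using (_≟_)
open import Relation.Nullary using (yes; no)
open import Relation.Binary.PropositionalEquality using (_≡_; _≢_)

-- Vertices: Fin (suc n); the root r is the vertex 'zero'.
-- Edges: Fin n; edge e joins the (non-root) vertex 'suc e' to its
-- parent vertex 'par e'.  So every non-root vertex 'suc e' is the lower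
-- endpoint of exactly one edge, namely e.  The acyclicity/connectivity
-- condition (every vertex reaches the root) is a hypothesis of the theorem
-- (see 'IsTree').

record Tree : Set where
  field
    n     : ℕ
    par   : Fin n → Fin (suc n)
    cost  : Fin n → ℚ
    prize : Fin (suc n) → ℚ

open Tree public

up : (G : Tree) → Fin (suc (n G)) → Fin (suc (n G))
up G zero    = zero
up G (suc e) = par G e

iter : (G : Tree) → ℕ → Fin (suc (n G)) → Fin (suc (n G))
iter G zero    v = v
iter G (suc k) v = iter G k (up G v)

IsTree : Tree → Set
IsTree G = ∀ v → ∃[ k ] iter G k v ≡ zero

EdgeSet : Tree → Set
EdgeSet G = Fin (n G) → Bool

∅ : (G : Tree) → EdgeSet G
∅ G e = false

ΣF : ∀ {m} → (Fin m → ℚ) → ℚ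
ΣF {zero}  f = 0ℚ
ΣF {suc m} f = f zero + ΣF (λ i → f (suc i))

count : ∀ {m} → (Fin m → Bool) → ℕ
count {zero}  S = zero
count {suc m} S = (if S zero then 1 else 0) ℕ.+ count (λ i → S (suc i))

costOf : (G : Tree) → EdgeSet G → ℚ
costOf G S = ΣF (λ e → if S e then cost G e else 0ℚ)

lowerPrize : (G : Tree) → EdgeSet G → ℚ
lowerPrize G S = ΣF (λ e → if S e then prize G (suc e) else 0ℚ)

-- p(T) for a rooted subtree T with edge set S: its vertices are r and the
-- lower endpoints of its edges
prizeRooted : (G : Tree) → EdgeSet G → ℚ
prizeRooted G S = prize G zero + lowerPrize G S

-- ratio with the convention that it is 0 when the cost is 0
-- (cost 0 happens exactly for the trivial tree, since costs are positive)
ratio : ℚ → ℚ → ℚ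
ratio a b with b ≟ 0ℚ
... | yes _  = 0ℚ
... | no b≢0 = _÷_ a b {{≢-nonZero b≢0}}

-- d(S) = (p(S) - p(r_S)) / c(S) for a subtree S of G with edge set S.
-- The vertex r_S closest to r is the unique vertex of S that is not the
-- lower endpoint of an edge of S, so p(S) - p(r_S) is the sum of the
-- prizes of the lower endpoints of the edges of S.
-- For a rooted subtree S (r_S = r) this is p(S)/c(S) when p(r) = 0, and 0
-- for the trivial tree.
dens : (G : Tree) → EdgeSet G → ℚ
dens G S = ratio (lowerPrize G S) (costOf G S)

-- Contraction G / B of a rooted subtree B (given by its edge set).
-- The vertices of B are r and the lower endpoints of the edges of B.
-- A vertex v lies in B  iff  v = r or v = suc q with q ∈ B.

VertexIn : (G : Tree) → EdgeSet G → Fin (suc (n G)) → Set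
VertexIn G B zero    = ⊤'
  where open import Data.Unit renaming (⊤ to ⊤')
VertexIn G B (suc q) = B q ≡ true

_∪_ : ∀ {G : Tree} → EdgeSet G → EdgeSet G → EdgeSet G
(A ∪ B) e = A e ∨ B e

_⊆_ : ∀ {G : Tree} → EdgeSet G → EdgeSet G → Set
_⊆_ {G} S S' = ∀ (e : Fin (n G)) → S e ≡ true → S' e ≡ true

-- Rooted subtrees of G / B, given by their extensions in G: edge sets S
-- of G disjoint from B such that every edge of S hangs below a vertex of
-- B (= the contracted root) or below another edge of S.
-- With B = ∅ G these are exactly the rooted subtrees of G.
RootedIn : (G : Tree) → EdgeSet G → EdgeSet G → Set
RootedIn G B S =
  (∀ e → S e ≡ true → B e ≡ false) ×
  (∀ e → S e ≡ true → VertexIn G (_∪_ {G} B S) (par G e))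

-- density in G / B of the rooted subtree (with extension) S:
-- the contracted root has prize 0, the other vertices of S in G / B are the
-- lower endpoints of the edges of S, with their original prizes.
densIn : (G : Tree) → EdgeSet G → EdgeSet G → ℚ
densIn G B S = ratio (lowerPrize G S) (costOf G S)

MaxDens : (G : Tree) → EdgeSet G → EdgeSet G → Set
MaxDens G B S = RootedIn G B S × (∀ S' → RootedIn G B S' → densIn G B S' ≤ densIn G B S)

MinMax : (G : Tree) → EdgeSet G → EdgeSet G → Set
MinMax G B S = MaxDens G B S × (∀ S' → MaxDens G B S' → _⊆_ {G} S' S → _⊆_ {G} S S')

-- total prize of G / B (the contracted root has prize 0)
totalPrizeIn : (G : Tree) → EdgeSet G → ℚ
totalPrizeIn G B = ΣF (λ e → if B e then 0ℚ else prize G (suc e))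

addEdge : (G : Tree) → EdgeSet G → Fin (n G) → EdgeSet G
addEdge G B e e' with e Data.Fin.≟ e'
  where import Data.Fin
... | yes _ = true
... | no _  = B e'

-- An iteration is recorded as (S , e): S is (the extension of) the chosen
-- min-max subtree of G / T̄, e is the edge of G corresponding to its
-- unique edge incident to the (contracted) root.

Step : Tree → Set
Step G = EdgeSet G × Fin (n G)

-- 'Run G B steps': the list 'steps' is a complete execution of the loop
-- starting from the current tree T̄ with edge set B.
Run : (G : Tree) → EdgeSet G → List (Step G) → Set
Run G B []             = totalPrizeIn G B ≡ 0ℚ
Run G B ((S , e) ∷ ss) =
  totalPrizeIn G B ≢ 0ℚ ×
  MinMax G B S ×
  S e ≡ true ×
  VertexIn G B (par G e) ×        -- incident to the contracted root
  Run G (addEdge G B e) ss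

-- The trees T_1, …, T_k: t_1 = 1, t_{i+1} = t_i + |E(T_i)|, T_i is the
-- extension of the min-max subtree chosen in iteration t_i, continued as
-- long as t_i ≤ number of iterations.  'blocksFrom k ss' skips k
-- iterations and then continues.
blocksFrom : (G : Tree) → ℕ → List (Step G) → List (EdgeSet G)
blocksFrom G k       []             = []
blocksFrom G zero    ((S , e) ∷ ss) = S ∷ blocksFrom G (count S ∸ 1) ss
blocksFrom G (suc k) (_ ∷ ss)       = blocksFrom G k ss

blocks : (G : Tree) → List (Step G) → List (EdgeSet G)
blocks G ss = blocksFrom G zero ss

ΣL : ∀ {A : Set} → (A → ℚ) → List A → ℚ
ΣL f []       = 0ℚ
ΣL f (x ∷ xs) = f x + ΣL f xs

{-# OPTIONS --safe #-}

-- For a density δ let the surplus of an edge set S be p(S) - δ c(S); it is additive over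
-- partitions, and a nonempty S has density at most δ iff its surplus is nonpositive.  Minimality
-- of a min-max subtree S of G/B makes every proper nonempty rooted part A of S strictly sparser
-- than S, so S minus A is strictly denser than S in G/(B ∪ A); hence the next max-density subtree
-- is denser than S, and comparing surpluses shows that it lies inside S.  So the iterations after
-- choosing S add exactly the edges of S, and the tree built before block T_j is
-- B = T_1 ∪ ... ∪ T_{j-1}.  With δ the density of the block chosen last (of T_1 at the start),
-- every rooted subtree of G/B has surplus ≤ 0 and B minus any rooted subtree T has surplus ≥ 0.
-- Splitting T along B then gives surplus_d(T) ≤ surplus_d(B) = Σ_{i<j} surplus_d(T_i) for
-- d = d(T_j), which is the claim since p(T_i) = d(T_i) c(T_i).

module Submission where

open import Defs
open import Data.Nat using (ℕ)
open import Data.Fin using (Fin; zero; toℕ)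
open import Data.List using (List; length; take; lookup)
open import Data.Rational using (ℚ; 0ℚ; _+_; _-_; _*_; _≤_; _<_)
open import Relation.Binary.PropositionalEquality using (_≡_)

open import Algebra.Bundles using (CommutativeMonoid)
open import Data.Bool using (Bool; true; false; _∨_; _∧_; not; if_then_else_)
open import Data.Bool.Properties
  using ( ∨-zeroʳ; ∨-identityʳ; ∨-conicalˡ; ∨-conicalʳ; ∧-zeroʳ; ∧-identityʳ; ∧-comm
        ; ∧-conicalˡ; ∧-conicalʳ; ∧-distribʳ-∨; not-injective)
  renaming (_≟_ to _≟ᵇ_)
open import Data.Empty using (⊥-elim)
open import Data.Fin using (suc)
import Data.Fin.Properties as Finₚ
open import Data.List using ([]; _∷_)
import Data.Nat as ℕ
import Data.Nat.Properties as ℕₚ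
open import Data.Product using (_×_; _,_; proj₁; proj₂; ∃-syntax)
open import Data.Rational using (-_; 1ℚ; 1/_; ≢-nonZero; positive; nonNegative)
open import Data.Rational.Properties
open import Data.Rational.Solver using (module +-*-Solver)
open import Data.Sum using (_⊎_; inj₁; inj₂; [_,_]′)
open import Function using (_∘_)
open import Relation.Binary.PropositionalEquality
  using (refl; sym; trans; cong; cong₂; subst; subst₂; _≢_; _≗_; module ≡-Reasoning)
open import Relation.Nullary using (yes; no; ¬_; contradiction)
open import Relation.Nullary.Decidable using (_×-dec_)

open import Algebra.Properties.CommutativeSemigroup
  (CommutativeMonoid.commutativeSemigroup +-0-commutativeMonoid) using (interchange)
open +-*-Solver using (solve; _:=_; _:+_; _:-_; _:*_)

Sub : ℕ → Set
Sub m = Fin m → Bool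

private
  variable
    m : ℕ
    x : Fin m
    A A′ B B′ B₀ C S S′ T U X : Sub m
    δ δ′ : ℚ

-- Rational arithmetic

p-q+q≡p : ∀ p q → p - q + q ≡ p
p-q+q≡p p q = trans (+-assoc p (- q) q) (trans (cong (p +_) (+-inverseˡ q)) (+-identityʳ p))

p≤q⇒p-q≤0 : ∀ {p q} → p ≤ q → p - q ≤ 0ℚ
p≤q⇒p-q≤0 {p} {q} p≤q = subst (p - q ≤_) (+-inverseʳ q) (+-monoˡ-≤ (- q) p≤q)

p-q≤0⇒p≤q : ∀ {p q} → p - q ≤ 0ℚ → p ≤ q
p-q≤0⇒p≤q {p} {q} p-q≤0 = subst₂ _≤_ (p-q+q≡p p q) (+-identityˡ q) (+-monoˡ-≤ q p-q≤0)

0≤p-q⇒q≤p : ∀ {p q} → 0ℚ ≤ p - q → q ≤ p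
0≤p-q⇒q≤p {p} {q} 0≤p-q = subst₂ _≤_ (+-identityˡ q) (p-q+q≡p p q) (+-monoˡ-≤ q 0≤p-q)

+-nonNeg : ∀ {p q} → 0ℚ ≤ p → 0ℚ ≤ q → 0ℚ ≤ p + q
+-nonNeg {p} {q} 0≤p 0≤q = subst (_≤ p + q) (+-identityʳ 0ℚ) (+-mono-≤ 0≤p 0≤q)

+-pos-nonNeg : ∀ {p q} → 0ℚ < p → 0ℚ ≤ q → 0ℚ < p + q
+-pos-nonNeg {p} {q} 0<p 0≤q = subst (_< p + q) (+-identityʳ 0ℚ) (+-mono-<-≤ 0<p 0≤q)

+-nonNeg-pos : ∀ {p q} → 0ℚ ≤ p → 0ℚ < q → 0ℚ < p + q
+-nonNeg-pos {p} {q} 0≤p 0<q = subst (_< p + q) (+-identityʳ 0ℚ) (+-mono-≤-< 0≤p 0<q)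

p+q≡0⇒p≤0⇒0≤q : ∀ {p q} → p + q ≡ 0ℚ → p ≤ 0ℚ → 0ℚ ≤ q
p+q≡0⇒p≤0⇒0≤q {p} {q} p+q≡0 p≤0 =
  subst₂ _≤_ p+q≡0 (+-identityˡ q) (+-monoˡ-≤ q p≤0)

p+q≡0⇒p<0⇒0<q : ∀ {p q} → p + q ≡ 0ℚ → p < 0ℚ → 0ℚ < q
p+q≡0⇒p<0⇒0<q {p} {q} p+q≡0 p<0 =
  subst₂ _<_ p+q≡0 (+-identityˡ q) (+-monoˡ-< q p<0)

p-q*0≡p : ∀ p q → p - q * 0ℚ ≡ p
p-q*0≡p p q = trans (cong (λ t → p - t) (*-zeroʳ q)) (+-identityʳ p)

[a+b]-d[x+y]≡[a-dx]+[b-dy] : ∀ a b x y d → (a + b) - d * (x + y) ≡ (a - d * x) + (b - d * y)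
[a+b]-d[x+y]≡[a-dx]+[b-dy] =
  solve 5 (λ a b x y d → (a :+ b) :- d :* (x :+ y) := (a :- d :* x) :+ (b :- d :* y)) refl

p≡0⇒p+q≤0⇒q≤0 : ∀ {p q} → p ≡ 0ℚ → p + q ≤ 0ℚ → q ≤ 0ℚ
p≡0⇒p+q≤0⇒q≤0 {p} {q} refl = subst (_≤ 0ℚ) (+-identityˡ q)

ratio-*-cancelʳ : ∀ a b → (b ≡ 0ℚ → a ≡ 0ℚ) → ratio a b * b ≡ a
ratio-*-cancelʳ a b b≡0⇒a≡0 with b ≟ 0ℚ
... | yes b≡0 = trans (*-zeroˡ b) (sym (b≡0⇒a≡0 b≡0))
... | no b≢0 = begin
  a * 1/b * b    ≡⟨ *-assoc a 1/b b ⟩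
  a * (1/b * b)  ≡⟨ cong (a *_) (*-inverseˡ b {{≢-nonZero b≢0}}) ⟩
  a * 1ℚ         ≡⟨ *-identityʳ a ⟩
  a              ∎
  where
  open ≡-Reasoning
  1/b : ℚ
  1/b = (1/ b) {{≢-nonZero b≢0}}

-- Edge sets as Boolean functions

infixr 6 _∪ₛ_
infixr 7 _∩ₛ_ _∖ₛ_
infix 4 _⊆ₛ_

_∪ₛ_ _∩ₛ_ _∖ₛ_ : Sub m → Sub m → Sub m
(A ∪ₛ B) x = A x ∨ B x
(A ∩ₛ B) x = A x ∧ B x
(A ∖ₛ B) x = A x ∧ not (B x)

_⊆ₛ_ : Sub m → Sub m → Set
A ⊆ₛ B = ∀ x → A x ≡ true → B x ≡ true

Disjoint : Sub m → Sub m → Set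
Disjoint A B = ∀ x → A x ≡ true → B x ≡ false

Partition : Sub m → Sub m → Sub m → Set
Partition U A B = Disjoint A B × U ≗ A ∪ₛ B

≗⇒⊆ : A ≗ B → A ⊆ₛ B
≗⇒⊆ A≗B x = trans (sym (A≗B x))

≗⇒⊇ : A ≗ B → B ⊆ₛ A
≗⇒⊇ A≗B x = trans (A≗B x)

⊆-refl : A ⊆ₛ A
⊆-refl _ Ax = Ax

⊆-trans : A ⊆ₛ B → B ⊆ₛ C → A ⊆ₛ C
⊆-trans A⊆B B⊆C x = B⊆C x ∘ A⊆B x

⊆-antisym : A ⊆ₛ B → B ⊆ₛ A → A ≗ B
⊆-antisym {A = A} {B = B} A⊆B B⊆A x with A x in Ax | B x in Bx
... | true  | true  = refl
... | false | false = refl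
... | true  | false = trans (sym (A⊆B x Ax)) Bx
... | false | true  = trans (sym Ax) (B⊆A x Bx)

⊆-false : A ⊆ₛ B → B x ≡ false → A x ≡ false
⊆-false {A = A} {x = x} A⊆B Bx with A x in Ax
... | true  = trans (sym (A⊆B x Ax)) Bx
... | false = refl

∪-⊆ˡ : (A B : Sub m) → A ⊆ₛ A ∪ₛ B
∪-⊆ˡ A B x Ax = cong (_∨ B x) Ax

∪-⊆ʳ : (A B : Sub m) → B ⊆ₛ A ∪ₛ B
∪-⊆ʳ A B x Bx = trans (cong (A x ∨_) Bx) (∨-zeroʳ (A x))

∪-elim : (A B : Sub m) → (A ∪ₛ B) x ≡ true → A x ≡ true ⊎ B x ≡ true
∪-elim {x = x} A B h with A x
... | true  = inj₁ refl
... | false = inj₂ h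

∪-lub : A ⊆ₛ C → B ⊆ₛ C → A ∪ₛ B ⊆ₛ C
∪-lub {A = A} {B = B} A⊆C B⊆C x h = [ A⊆C x , B⊆C x ]′ (∪-elim A B h)

∪-mono : A ⊆ₛ A′ → B ⊆ₛ B′ → A ∪ₛ B ⊆ₛ A′ ∪ₛ B′
∪-mono {A′ = A′} {B′ = B′} A⊆A′ B⊆B′ = ∪-lub (⊆-trans A⊆A′ (∪-⊆ˡ A′ B′)) (⊆-trans B⊆B′ (∪-⊆ʳ A′ B′))

∪-monoʳ : (A : Sub m) → B ⊆ₛ B′ → A ∪ₛ B ⊆ₛ A ∪ₛ B′
∪-monoʳ A = ∪-mono (⊆-refl {A = A})

∩-⊆ˡ : (A B : Sub m) → A ∩ₛ B ⊆ₛ A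
∩-⊆ˡ A B x = ∧-conicalˡ (A x) (B x)

∩-⊆ʳ : (A B : Sub m) → A ∩ₛ B ⊆ₛ B
∩-⊆ʳ A B x = ∧-conicalʳ (A x) (B x)

∖-⊆ : (A B : Sub m) → A ∖ₛ B ⊆ₛ A
∖-⊆ A B x = ∧-conicalˡ (A x) (not (B x))

∖-∉ : (A B : Sub m) → (A ∖ₛ B) x ≡ true → B x ≡ false
∖-∉ {x = x} A B h = not-injective {y = false} (∧-conicalʳ (A x) (not (B x)) h)

⊆-∪-∖ : (A B : Sub m) → A ⊆ₛ B ∪ₛ A ∖ₛ B
⊆-∪-∖ A B x Ax with B x
... | true  = refl
... | false = trans (∧-identityʳ (A x)) Ax

∪-∩-⊆ : (S′ S : Sub m) → B₀ ⊆ₛ B → (B ∪ₛ S′) ∩ₛ (B₀ ∪ₛ S) ⊆ₛ B ∪ₛ S′ ∩ₛ S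
∪-∩-⊆ {B₀ = B₀} {B = B} S′ S B₀⊆B x h with B x in Bx
... | true  = refl
... | false = cong₂ _∧_ S′x Sx
  where
  S′x : S′ x ≡ true
  S′x = ∧-conicalˡ _ _ h
  Sx : S x ≡ true
  Sx = trans (cong (_∨ S x) (sym (⊆-false B₀⊆B Bx))) (∧-conicalʳ _ _ h)

Disjoint-sym : Disjoint A B → Disjoint B A
Disjoint-sym {A = A} A∩B=∅ x Bx with A x in Ax
... | true  = trans (sym Bx) (A∩B=∅ x Ax)
... | false = refl

Disjoint-⊆ʳ : B′ ⊆ₛ B → Disjoint A B → Disjoint A B′
Disjoint-⊆ʳ B′⊆B A∩B=∅ x Ax = ⊆-false B′⊆B (A∩B=∅ x Ax)

Disjoint-∖ : (A B : Sub m) → Disjoint A (B ∖ₛ A)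
Disjoint-∖ A B x Ax = trans (cong (λ a → B x ∧ not a) Ax) (∧-zeroʳ (B x))

∩-∖-partition : (A B : Sub m) → Partition A (A ∩ₛ B) (A ∖ₛ B)
∩-∖-partition A B = disjoint , cover
  where
  disjoint : Disjoint (A ∩ₛ B) (A ∖ₛ B)
  disjoint x h = trans (cong (λ b → A x ∧ not b) (∩-⊆ʳ A B x h)) (∧-zeroʳ (A x))
  cover : A ≗ A ∩ₛ B ∪ₛ A ∖ₛ B
  cover x with A x | B x
  ... | true  | true  = refl
  ... | true  | false = refl
  ... | false | _     = refl

⊆-∖-partition : A ⊆ₛ S → Partition S A (S ∖ₛ A)
⊆-∖-partition {A = A} {S = S} A⊆S = Disjoint-∖ A S , cover
  where
  cover : S ≗ A ∪ₛ S ∖ₛ A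
  cover x with A x in Ax
  ... | true  = A⊆S x Ax
  ... | false = sym (∧-identityʳ (S x))

∪-∖-partition : (A B : Sub m) → Partition (A ∪ₛ B) A (B ∖ₛ A)
∪-∖-partition A B = Disjoint-∖ A B , cover
  where
  cover : A ∪ₛ B ≗ A ∪ₛ B ∖ₛ A
  cover x with A x
  ... | true  = refl
  ... | false = sym (∧-identityʳ (B x))

Disjoint⇒Partition-∪ : Disjoint A B → Partition (A ∪ₛ B) A B
Disjoint⇒Partition-∪ A∩B=∅ = A∩B=∅ , λ x → refl

Partition-∖ : Partition U A B → Partition (U ∖ₛ X) (A ∖ₛ X) (B ∖ₛ X)
Partition-∖ {U = U} {A = A} {B = B} {X = X} (A∩B=∅ , U≗) = disjoint , cover
  where
  disjoint : Disjoint (A ∖ₛ X) (B ∖ₛ X)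
  disjoint x h = cong (_∧ not (X x)) (A∩B=∅ x (∖-⊆ A X x h))
  cover : U ∖ₛ X ≗ A ∖ₛ X ∪ₛ B ∖ₛ X
  cover x = trans (cong (_∧ not (X x)) (U≗ x)) (∧-distribʳ-∨ (not (X x)) (A x) (B x))

-- Sums and counts

-- costOf G and lowerPrize G are, definitionally, ΣS _ (cost G) and ΣS _ (prize G ∘ suc).
ΣS : Sub m → (Fin m → ℚ) → ℚ
ΣS A w = ΣF (λ x → if A x then w x else 0ℚ)

ΣF-cong : {f g : Fin m → ℚ} → f ≗ g → ΣF f ≡ ΣF g
ΣF-cong {m = ℕ.zero}  f≗g = refl
ΣF-cong {m = ℕ.suc m} f≗g = cong₂ _+_ (f≗g zero) (ΣF-cong (f≗g ∘ suc))

ΣF-+ : (f g : Fin m → ℚ) → ΣF (λ x → f x + g x) ≡ ΣF f + ΣF g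
ΣF-+ {m = ℕ.zero}  f g = sym (+-identityˡ 0ℚ)
ΣF-+ {m = ℕ.suc m} f g = trans (cong (f zero + g zero +_) (ΣF-+ (f ∘ suc) (g ∘ suc)))
                                (interchange (f zero) (g zero) (ΣF (f ∘ suc)) (ΣF (g ∘ suc)))

ΣS-cong : A ≗ B → (w : Fin m → ℚ) → ΣS A w ≡ ΣS B w
ΣS-cong A≗B w = ΣF-cong (λ x → cong (λ b → if b then w x else 0ℚ) (A≗B x))

ΣS-partition : Partition U A B → (w : Fin m → ℚ) → ΣS U w ≡ ΣS A w + ΣS B w
ΣS-partition {U = U} {A = A} {B = B} (A∩B=∅ , U≗) w =
  trans (ΣF-cong pointwise) (ΣF-+ (λ x → if A x then w x else 0ℚ) (λ x → if B x then w x else 0ℚ))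
  where
  pointwise : ∀ x → (if U x then w x else 0ℚ) ≡ (if A x then w x else 0ℚ) + (if B x then w x else 0ℚ)
  pointwise x rewrite U≗ x with A x in Ax
  ... | true rewrite A∩B=∅ x Ax = sym (+-identityʳ (w x))
  ... | false with B x
  ...   | true  = sym (+-identityˡ (w x))
  ...   | false = sym (+-identityˡ 0ℚ)

ΣS-empty : (∀ x → A x ≡ false) → (w : Fin m → ℚ) → ΣS A w ≡ 0ℚ
ΣS-empty {m = ℕ.zero}  A=∅ w = refl
ΣS-empty {m = ℕ.suc m} A=∅ w =
  trans (cong₂ (λ b s → (if b then w zero else 0ℚ) + s) (A=∅ zero) (ΣS-empty (A=∅ ∘ suc) (w ∘ suc)))
        (+-identityˡ 0ℚ)

if-nonNeg : ∀ b {q} → 0ℚ ≤ q → 0ℚ ≤ (if b then q else 0ℚ)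
if-nonNeg true  0≤q = 0≤q
if-nonNeg false _   = ≤-refl

ΣS-nonNeg : {w : Fin m → ℚ} → (∀ x → 0ℚ ≤ w x) → 0ℚ ≤ ΣS A w
ΣS-nonNeg {m = ℕ.zero}  w≥0 = ≤-refl
ΣS-nonNeg {m = ℕ.suc m} {A = A} w≥0 = +-nonNeg (if-nonNeg (A zero) (w≥0 zero)) (ΣS-nonNeg (w≥0 ∘ suc))

ΣS-pos : {w : Fin m → ℚ} → (∀ x → 0ℚ < w x) → A x ≡ true → 0ℚ < ΣS A w
ΣS-pos {A = A} {x = zero} {w = w} w>0 Ax =
  +-pos-nonNeg (subst (λ b → 0ℚ < (if b then w zero else 0ℚ)) (sym Ax) (w>0 zero))
               (ΣS-nonNeg (<⇒≤ ∘ w>0 ∘ suc))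
ΣS-pos {A = A} {x = suc x} w>0 Ax =
  +-nonNeg-pos (if-nonNeg (A zero) (<⇒≤ (w>0 zero))) (ΣS-pos (w>0 ∘ suc) Ax)

count-cong : {A B : Sub m} → A ≗ B → count A ≡ count B
count-cong {m = ℕ.zero}  A≗B = refl
count-cong {m = ℕ.suc m} A≗B =
  cong₂ ℕ._+_ (cong (λ b → if b then 1 else 0) (A≗B zero)) (count-cong (A≗B ∘ suc))

count-∅ : count {m} (λ _ → false) ≡ 0
count-∅ {m = ℕ.zero}  = refl
count-∅ {m = ℕ.suc m} = count-∅ {m}

count-mono : {A B : Sub m} → A ⊆ₛ B → count A ℕ.≤ count B
count-mono {m = ℕ.zero} _ = ℕ.z≤n
count-mono {m = ℕ.suc m} {A = A} {B = B} A⊆B with A zero in A0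
... | true rewrite A⊆B zero A0 = ℕ.s≤s (count-mono (A⊆B ∘ suc))
... | false with B zero
...   | true  = ℕₚ.m≤n⇒m≤1+n (count-mono (A⊆B ∘ suc))
...   | false = count-mono (A⊆B ∘ suc)

count-< : A ⊆ₛ B → B x ≡ true → A x ≡ false → count A ℕ.< count B
count-< {A = A} {B = B} {x = zero} A⊆B Bx Ax rewrite Bx | Ax = ℕ.s≤s (count-mono (A⊆B ∘ suc))
count-< {A = A} {B = B} {x = suc x} A⊆B Bx Ax with A zero in A0
... | true rewrite A⊆B zero A0 = ℕ.s≤s (count-< (A⊆B ∘ suc) Bx Ax)
... | false with B zero
...   | true  = ℕₚ.m≤n⇒m≤1+n (count-< (A⊆B ∘ suc) Bx Ax)
...   | false = count-< (A⊆B ∘ suc) Bx Ax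

count-insert : A x ≡ false → A′ x ≡ true → (∀ y → x ≢ y → A′ y ≡ A y) → count A′ ≡ ℕ.suc (count A)
count-insert {x = zero} Ax A′x A′≗A rewrite Ax | A′x = cong ℕ.suc (count-cong (λ y → A′≗A (suc y) (λ ())))
count-insert {A = A} {x = suc x} Ax A′x A′≗A rewrite A′≗A zero (λ ()) =
  trans (cong ((if A zero then 1 else 0) ℕ.+_)
              (count-insert Ax A′x (λ y x≢y → A′≗A (suc y) (x≢y ∘ Finₚ.suc-injective))))
        (ℕₚ.+-suc _ _)

⊆-count-≡⇒⊇ : A ⊆ₛ B → count A ≡ count B → B ⊆ₛ A
⊆-count-≡⇒⊇ {A = A} A⊆B |A|≡|B| x Bx with A x in Ax
... | true  = refl
... | false = ⊥-elim (ℕₚ.<-irrefl |A|≡|B| (count-< A⊆B Bx Ax))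

⊆-count-<⇒∃∖ : A ⊆ₛ B → count A ℕ.< count B → ∃[ x ] B x ≡ true × A x ≡ false
⊆-count-<⇒∃∖ {A = A} {B = B} A⊆B |A|<|B|
  with Finₚ.any? (λ x → (B x ≟ᵇ true) ×-dec (A x ≟ᵇ false))
... | yes found = found
... | no none = ⊥-elim (ℕₚ.<⇒≱ |A|<|B| (count-mono B⊆A))
  where
  B⊆A : B ⊆ₛ A
  B⊆A x Bx with A x in Ax
  ... | true  = refl
  ... | false = ⊥-elim (none (x , Bx , Ax))

-- Rooted subtrees of contractions

module Subtrees (G : Tree) where

  VertexIn-mono : ∀ {v} → A ⊆ₛ B → VertexIn G A v → VertexIn G B v
  VertexIn-mono {v = zero}  _   v∈A = v∈A
  VertexIn-mono {v = suc q} A⊆B v∈A = A⊆B q v∈A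

  VertexIn-∩ : ∀ {v} → VertexIn G A v → VertexIn G B v → VertexIn G (A ∩ₛ B) v
  VertexIn-∩ {v = zero}  v∈A _   = v∈A
  VertexIn-∩ {v = suc q} v∈A v∈B = cong₂ _∧_ v∈A v∈B

  addEdge-self : ∀ e → addEdge G A e e ≡ true
  addEdge-self e with e Finₚ.≟ e
  ... | yes _   = refl
  ... | no e≢e = ⊥-elim (e≢e refl)

  addEdge-⊇ : ∀ e → A ⊆ₛ addEdge G A e
  addEdge-⊇ e x Ax with e Finₚ.≟ x
  ... | yes _ = refl
  ... | no _  = Ax

  addEdge-other : ∀ {e x} → e ≢ x → addEdge G A e x ≡ A x
  addEdge-other {e = e} {x} e≢x with e Finₚ.≟ x
  ... | yes e≡x = ⊥-elim (e≢x e≡x)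
  ... | no _    = refl

  addEdge-elim : ∀ {e x} → addEdge G A e x ≡ true → e ≡ x ⊎ A x ≡ true
  addEdge-elim {e = e} {x} h with e Finₚ.≟ x
  ... | yes e≡x = inj₁ e≡x
  ... | no _    = inj₂ h

  addEdge-∪ : ∀ e → B ≗ B₀ ∪ₛ A → addEdge G B e ≗ B₀ ∪ₛ addEdge G A e
  addEdge-∪ {B₀ = B₀} e B≗ x with e Finₚ.≟ x
  ... | yes _ = sym (∨-zeroʳ (B₀ x))
  ... | no _  = B≗ x

  count-addEdge : ∀ {e} → A e ≡ false → count (addEdge G A e) ≡ ℕ.suc (count A)
  count-addEdge {A = A} {e} Ae = count-insert {A = A} Ae (addEdge-self e) (λ _ → addEdge-other {A = A} {e = e})

  rooted-∅ : RootedIn G B (λ _ → false)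
  rooted-∅ = (λ _ ()) , (λ _ ())

  rooted-∖ : B ≗ B₀ ∪ₛ A → RootedIn G B₀ S → RootedIn G B (S ∖ₛ A)
  rooted-∖ {B = B} {B₀ = B₀} {A = A} {S = S} B≗ (S∩B₀=∅ , S-hangs) = disjoint , hangs
    where
    disjoint : Disjoint (S ∖ₛ A) B
    disjoint x h = trans (B≗ x) (cong₂ _∨_ (S∩B₀=∅ x (∖-⊆ S A x h)) (∖-∉ S A h))
    B₀⊆B : B₀ ⊆ₛ B
    B₀⊆B = ⊆-trans (∪-⊆ˡ B₀ A) (≗⇒⊇ B≗)
    A⊆B : A ⊆ₛ B
    A⊆B = ⊆-trans (∪-⊆ʳ B₀ A) (≗⇒⊇ B≗)
    B₀∪S⊆B∪S∖A : B₀ ∪ₛ S ⊆ₛ B ∪ₛ S ∖ₛ A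
    B₀∪S⊆B∪S∖A = ∪-lub (⊆-trans B₀⊆B (∪-⊆ˡ B (S ∖ₛ A))) (⊆-trans (⊆-∪-∖ S A) (∪-mono A⊆B ⊆-refl))
    hangs : ∀ e → (S ∖ₛ A) e ≡ true → VertexIn G (B ∪ₛ S ∖ₛ A) (par G e)
    hangs e h = VertexIn-mono B₀∪S⊆B∪S∖A (S-hangs e (∖-⊆ S A e h))

  rooted-∩ : B₀ ⊆ₛ B → RootedIn G B₀ S → RootedIn G B S′ → RootedIn G B (S′ ∩ₛ S)
  rooted-∩ {B = B} {S = S} {S′ = S′} B₀⊆B (_ , S-hangs) (S′∩B=∅ , S′-hangs) = disjoint , hangs
    where
    disjoint : Disjoint (S′ ∩ₛ S) B
    disjoint x h = S′∩B=∅ x (∩-⊆ˡ S′ S x h)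
    hangs : ∀ e → (S′ ∩ₛ S) e ≡ true → VertexIn G (B ∪ₛ S′ ∩ₛ S) (par G e)
    hangs e h = VertexIn-mono (∪-∩-⊆ S′ S B₀⊆B)
      (VertexIn-∩ (S′-hangs e (∩-⊆ˡ S′ S e h)) (S-hangs e (∩-⊆ʳ S′ S e h)))

  rooted-∪ : B ⊆ₛ B′ → B′ ⊆ₛ B ∪ₛ S → RootedIn G B S → RootedIn G B′ S′ → RootedIn G B (S ∪ₛ S′)
  rooted-∪ {B = B} {B′ = B′} {S = S} {S′ = S′} B⊆B′ B′⊆B∪S (S∩B=∅ , S-hangs) (S′∩B′=∅ , S′-hangs) =
    disjoint , hangs
    where
    disjoint : Disjoint (S ∪ₛ S′) B
    disjoint x h with ∪-elim S S′ h
    ... | inj₁ Sx  = S∩B=∅ x Sx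
    ... | inj₂ S′x = ⊆-false B⊆B′ (S′∩B′=∅ x S′x)
    B∪S⊆ : B ∪ₛ S ⊆ₛ B ∪ₛ S ∪ₛ S′
    B∪S⊆ = ∪-monoʳ B (∪-⊆ˡ S S′)
    B′∪S′⊆ : B′ ∪ₛ S′ ⊆ₛ B ∪ₛ S ∪ₛ S′
    B′∪S′⊆ = ∪-lub (⊆-trans B′⊆B∪S B∪S⊆) (⊆-trans (∪-⊆ʳ S S′) (∪-⊆ʳ B (S ∪ₛ S′)))
    hangs : ∀ e → (S ∪ₛ S′) e ≡ true → VertexIn G (B ∪ₛ S ∪ₛ S′) (par G e)
    hangs e h with ∪-elim S S′ h
    ... | inj₁ Se  = VertexIn-mono B∪S⊆ (S-hangs e Se)
    ... | inj₂ S′e = VertexIn-mono B′∪S′⊆ (S′-hangs e S′e)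

  rooted-addEdge : ∀ {e} → RootedIn G B₀ A → B₀ e ≡ false → VertexIn G (B₀ ∪ₛ A) (par G e) →
                   RootedIn G B₀ (addEdge G A e)
  rooted-addEdge {B₀ = B₀} {A = A} {e} (A∩B₀=∅ , A-hangs) B₀e e-hangs = disjoint , hangs
    where
    disjoint : Disjoint (addEdge G A e) B₀
    disjoint x h with addEdge-elim {A = A} {e = e} {x = x} h
    ... | inj₁ refl = B₀e
    ... | inj₂ Ax   = A∩B₀=∅ x Ax
    grow : B₀ ∪ₛ A ⊆ₛ B₀ ∪ₛ addEdge G A e
    grow = ∪-monoʳ B₀ (addEdge-⊇ e)
    hangs : ∀ x → addEdge G A e x ≡ true → VertexIn G (B₀ ∪ₛ addEdge G A e) (par G x)
    hangs x h with addEdge-elim {A = A} {e = e} {x = x} h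
    ... | inj₁ refl = VertexIn-mono grow e-hangs
    ... | inj₂ Ax   = VertexIn-mono grow (A-hangs x Ax)

-- Surplus and density

module Greedy (G : Tree) (cost-pos : ∀ e → 0ℚ < cost G e) where
  open Subtrees G

  p c : EdgeSet G → ℚ
  p = lowerPrize G
  c = costOf G

  surplus : ℚ → EdgeSet G → ℚ
  surplus δ S = p S - δ * c S

  c-nonNeg : ∀ S → 0ℚ ≤ c S
  c-nonNeg S = ΣS-nonNeg {A = S} (<⇒≤ ∘ cost-pos)

  c-pos : ∀ S {x} → S x ≡ true → 0ℚ < c S
  c-pos S = ΣS-pos {A = S} cost-pos

  c≡0⇒p≡0 : ∀ S → c S ≡ 0ℚ → p S ≡ 0ℚ
  c≡0⇒p≡0 S c≡0 = ΣS-empty S=∅ (prize G ∘ suc)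
    where
    S=∅ : ∀ x → S x ≡ false
    S=∅ x with S x in Sx
    ... | true  = ⊥-elim (<⇒≢ (c-pos S Sx) (sym c≡0))
    ... | false = refl

  dens-*-c : ∀ S → dens G S * c S ≡ p S
  dens-*-c S = ratio-*-cancelʳ (p S) (c S) (c≡0⇒p≡0 S)

  surplus-dens : ∀ S → surplus (dens G S) S ≡ 0ℚ
  surplus-dens S = trans (cong (_- dens G S * c S) (sym (dens-*-c S))) (+-inverseʳ (dens G S * c S))

  surplus-partition : ∀ δ → Partition U A B → surplus δ U ≡ surplus δ A + surplus δ B
  surplus-partition {U = U} {A = A} {B = B} δ U=A⊎B =
    trans (cong₂ (λ a b → a - δ * b) (ΣS-partition U=A⊎B _) (ΣS-partition U=A⊎B _))
          ([a+b]-d[x+y]≡[a-dx]+[b-dy] (p A) (p B) (c A) (c B) δ)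

  surplus-cong : ∀ δ → A ≗ B → surplus δ A ≡ surplus δ B
  surplus-cong δ A≗B = cong₂ (λ a b → a - δ * b) (ΣS-cong A≗B _) (ΣS-cong A≗B _)

  surplus-∅ : ∀ δ → (∀ x → A x ≡ false) → surplus δ A ≡ 0ℚ
  surplus-∅ δ A=∅ =
    trans (cong₂ (λ a b → a - δ * b) (ΣS-empty A=∅ _) (ΣS-empty A=∅ _)) (p-q*0≡p 0ℚ δ)

  surplus-antitone : ∀ S → δ ≤ δ′ → surplus δ′ S ≤ surplus δ S
  surplus-antitone S δ≤δ′ =
    +-monoʳ-≤ (p S) (neg-antimono-≤ (*-monoʳ-≤-nonNeg (c S) {{nonNegative (c-nonNeg S)}} δ≤δ′))

  surplus-antitone-< : ∀ S → δ < δ′ → 0ℚ < c S → surplus δ′ S < surplus δ S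
  surplus-antitone-< S δ<δ′ 0<cS =
    +-monoʳ-< (p S) (neg-antimono-< (*-monoˡ-<-pos (c S) {{positive 0<cS}} δ<δ′))

  dens≤⇒surplus≤0 : ∀ S → dens G S ≤ δ → surplus δ S ≤ 0ℚ
  dens≤⇒surplus≤0 {δ = δ} S dS≤δ =
    p≤q⇒p-q≤0 (subst (_≤ δ * c S) (dens-*-c S) (*-monoʳ-≤-nonNeg (c S) {{nonNegative (c-nonNeg S)}} dS≤δ))

  surplus≤0⇒dens≤ : ∀ S → 0ℚ < c S → surplus δ S ≤ 0ℚ → dens G S ≤ δ
  surplus≤0⇒dens≤ {δ = δ} S 0<cS s≤0 =
    *-cancelʳ-≤-pos (c S) {{positive 0<cS}} (subst (_≤ δ * c S) (sym (dens-*-c S)) (p-q≤0⇒p≤q s≤0))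

  0≤surplus⇒≤dens : ∀ S → 0ℚ < c S → 0ℚ ≤ surplus δ S → δ ≤ dens G S
  0≤surplus⇒≤dens {δ = δ} S 0<cS 0≤s =
    *-cancelʳ-≤-pos (c S) {{positive 0<cS}} (subst (δ * c S ≤_) (sym (dens-*-c S)) (0≤p-q⇒q≤p 0≤s))

  maxDens⇒surplus≤0 : MaxDens G B S → RootedIn G B S′ → surplus (dens G S) S′ ≤ 0ℚ
  maxDens⇒surplus≤0 (_ , maximal) rS′ = dens≤⇒surplus≤0 _ (maximal _ rS′)

  -- The greedy run

  DensityAtMost : EdgeSet G → ℚ → Set
  DensityAtMost B δ = ∀ S → RootedIn G B S → surplus δ S ≤ 0ℚ

  RemaindersAtLeast : EdgeSet G → ℚ → Set
  RemaindersAtLeast B δ = ∀ T → RootedIn G (∅ G) T → 0ℚ ≤ surplus δ (B ∖ₛ T)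

  chosen-dens≤ : DensityAtMost B δ → MaxDens G B S → S x ≡ true → dens G S ≤ δ
  chosen-dens≤ {S = S} atMost (rS , _) Sx = surplus≤0⇒dens≤ S (c-pos S Sx) (atMost S rS)

  next-block-bound : RemaindersAtLeast B δ → MaxDens G B S → dens G S ≤ δ → RootedIn G (∅ G) T →
                      surplus (dens G S) T ≤ surplus (dens G S) B
  next-block-bound {B = B} {S = S} {T = T} remainders maxS dS≤δ rT = begin
    s T                       ≡⟨ surplus-partition δS (∩-∖-partition T B) ⟩
    s (T ∩ₛ B) + s (T ∖ₛ B)  ≤⟨ +-monoʳ-≤ (s (T ∩ₛ B)) (≤-trans outside≤0 0≤remainder) ⟩
    s (T ∩ₛ B) + s (B ∖ₛ T)  ≡⟨ cong (_+ s (B ∖ₛ T)) (surplus-cong δS (λ x → ∧-comm (T x) (B x))) ⟩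
    s (B ∩ₛ T) + s (B ∖ₛ T)  ≡⟨ surplus-partition δS (∩-∖-partition B T) ⟨
    s B                       ∎
    where
    open ≤-Reasoning
    δS : ℚ
    δS = dens G S
    s : EdgeSet G → ℚ
    s = surplus δS
    outside≤0 : s (T ∖ₛ B) ≤ 0ℚ
    outside≤0 = maxDens⇒surplus≤0 maxS (rooted-∖ (λ _ → refl) rT)
    0≤remainder : 0ℚ ≤ s (B ∖ₛ T)
    0≤remainder = ≤-trans (remainders T rT) (surplus-antitone (B ∖ₛ T) dS≤δ)

  remainders-step : RemaindersAtLeast B δ → MaxDens G B S → dens G S ≤ δ → B′ ≗ B ∪ₛ S →
                    RemaindersAtLeast B′ (dens G S)
  remainders-step {B = B} {S = S} {B′ = B′} remainders maxS@(rS , _) dS≤δ B′≗ T rT = begin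
    0ℚ                        ≤⟨ +-nonNeg 0≤old 0≤new ⟩
    s (B ∖ₛ T) + s (S ∖ₛ T)  ≡⟨ surplus-partition δS (Partition-∖ (Disjoint-sym (proj₁ rS) , B′≗)) ⟨
    s (B′ ∖ₛ T)               ∎
    where
    open ≤-Reasoning
    δS : ℚ
    δS = dens G S
    s : EdgeSet G → ℚ
    s = surplus δS
    0≤old : 0ℚ ≤ s (B ∖ₛ T)
    0≤old = ≤-trans (remainders T rT) (surplus-antitone (B ∖ₛ T) dS≤δ)
    0≤new : 0ℚ ≤ s (S ∖ₛ T)
    0≤new = p+q≡0⇒p≤0⇒0≤q (trans (sym (surplus-partition δS (∩-∖-partition S T))) (surplus-dens S))
                           (maxDens⇒surplus≤0 maxS (rooted-∩ (λ _ ()) rT rS))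

  densityAtMost-step : MaxDens G B S → B′ ≗ B ∪ₛ S → DensityAtMost B′ (dens G S)
  densityAtMost-step {B = B} {S = S} {B′ = B′} maxS@(rS , _) B′≗ S′ rS′ =
    p≡0⇒p+q≤0⇒q≤0 (surplus-dens S)
      (subst (_≤ 0ℚ) (surplus-partition (dens G S) (Disjoint⇒Partition-∪ S∩S′=∅)) S∪S′≤0)
    where
    S⊆B′ : S ⊆ₛ B′
    S⊆B′ = ⊆-trans (∪-⊆ʳ B S) (≗⇒⊇ B′≗)
    S∩S′=∅ : Disjoint S S′
    S∩S′=∅ = Disjoint-sym (Disjoint-⊆ʳ S⊆B′ (proj₁ rS′))
    S∪S′≤0 : surplus (dens G S) (S ∪ₛ S′) ≤ 0ℚ
    S∪S′≤0 = maxDens⇒surplus≤0 maxS (rooted-∪ (⊆-trans (∪-⊆ˡ B S) (≗⇒⊇ B′≗)) (≗⇒⊆ B′≗) rS rS′)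

  record RootedPart (B₀ S A : EdgeSet G) : Set where
    field
      part-⊆ : A ⊆ₛ S
      part-rooted : RootedIn G B₀ A
      part-inhabited : ∃[ x ] A x ≡ true

  proper-part-sparse : MinMax G B₀ S → RootedPart B₀ S A → S x ≡ true → A x ≡ false →
                       surplus (dens G S) A < 0ℚ
  proper-part-sparse {B₀ = B₀} {S = S} {A = A} {x = x} (maxS , minimal) part Sx Ax = ≰⇒> A-not-sparse
    where
    open RootedPart part
    A-not-sparse : ¬ 0ℚ ≤ surplus (dens G S) A
    A-not-sparse 0≤sA = contradiction (trans (sym (minimal A maxA part-⊆ x Sx)) Ax) λ ()
      where
      maxA : MaxDens G B₀ A
      maxA = part-rooted , λ S′ rS′ →
        ≤-trans (proj₂ maxS S′ rS′) (0≤surplus⇒≤dens A (c-pos A (proj₂ part-inhabited)) 0≤sA)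

  chosen-dens-< : MinMax G B₀ S → RootedPart B₀ S A → S x ≡ true → A x ≡ false → B ≗ B₀ ∪ₛ A →
                  MaxDens G B S′ → dens G S < dens G S′
  chosen-dens-< {S = S} {A = A} {S′ = S′} minS@((rS , _) , _) part Sx Ax B≗ maxS′ = ≰⇒> λ dS′≤dS →
    <-irrefl refl (begin-strict
      0ℚ                              <⟨ 0<rest ⟩
      surplus (dens G S) (S ∖ₛ A)     ≤⟨ surplus-antitone (S ∖ₛ A) dS′≤dS ⟩
      surplus (dens G S′) (S ∖ₛ A)    ≤⟨ rest≤0 ⟩
      0ℚ                              ∎)
    where
    open RootedPart part
    open ≤-Reasoning
    0<rest : 0ℚ < surplus (dens G S) (S ∖ₛ A)
    0<rest = p+q≡0⇒p<0⇒0<q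
      (trans (sym (surplus-partition (dens G S) (⊆-∖-partition part-⊆))) (surplus-dens S))
      (proper-part-sparse minS part Sx Ax)
    rest≤0 : surplus (dens G S′) (S ∖ₛ A) ≤ 0ℚ
    rest≤0 = maxDens⇒surplus≤0 maxS′ (rooted-∖ B≗ rS)

  -- An edge of S′ outside S would make Y = S′ ∖ S nonempty, with surplus ≥ 0 at d(S′) and ≤ 0 at
  -- the smaller density d(S).
  next-edge-in-chosen : MinMax G B₀ S → RootedPart B₀ S A → S x ≡ true → A x ≡ false → B ≗ B₀ ∪ₛ A →
                        MaxDens G B S′ → ∀ {e} → S′ e ≡ true → S e ≡ true
  next-edge-in-chosen {B₀ = B₀} {S = S} {A = A} {B = B} {S′ = S′}
                      minS@(maxS@(rS , _) , _) part Sx Ax B≗ maxS′@(rS′ , _) {e} S′e with S e in Se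
  ... | true  = refl
  ... | false = ⊥-elim (<-irrefl refl (begin-strict
        0ℚ                    ≤⟨ 0≤outside′ ⟩
        surplus (dens G S′) Y <⟨ surplus-antitone-< Y (chosen-dens-< minS part Sx Ax B≗ maxS′) (c-pos Y Ye) ⟩
        surplus (dens G S) Y  ≤⟨ outside≤0 ⟩
        0ℚ                    ∎))
    where
    open RootedPart part
    open ≤-Reasoning
    Y : EdgeSet G
    Y = S′ ∖ₛ S
    Ye : Y e ≡ true
    Ye = cong₂ (λ a b → a ∧ not b) S′e Se
    B₀⊆B : B₀ ⊆ₛ B
    B₀⊆B = ⊆-trans (∪-⊆ˡ B₀ A) (≗⇒⊇ B≗)
    B⊆B₀∪S : B ⊆ₛ B₀ ∪ₛ S
    B⊆B₀∪S = ⊆-trans (≗⇒⊆ B≗) (∪-monoʳ B₀ part-⊆)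
    outside≤0 : surplus (dens G S) Y ≤ 0ℚ
    outside≤0 = p≡0⇒p+q≤0⇒q≤0 (surplus-dens S)
      (subst (_≤ 0ℚ) (surplus-partition (dens G S) (∪-∖-partition S S′))
             (maxDens⇒surplus≤0 maxS (rooted-∪ B₀⊆B B⊆B₀∪S rS rS′)))
    0≤outside′ : 0ℚ ≤ surplus (dens G S′) Y
    0≤outside′ = p+q≡0⇒p≤0⇒0≤q
      (trans (sym (surplus-partition (dens G S′) (∩-∖-partition S′ S))) (surplus-dens S′))
      (maxDens⇒surplus≤0 maxS′ (rooted-∩ B₀⊆B rS rS′))

  record Resumption (B₀ S : EdgeSet G) (Ts : List (EdgeSet G)) : Set where
    constructor resumes
    field
      state : EdgeSet G
      remaining : List (Step G)
      state≗ : state ≗ B₀ ∪ₛ S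
      remaining-run : Run G state remaining
      blocks≡ : Ts ≡ blocks G remaining

  Completes : EdgeSet G → EdgeSet G → List (EdgeSet G) → Set
  Completes B₀ S Ts = Ts ≡ [] ⊎ Resumption B₀ S Ts

  completes : ∀ k run → MinMax G B₀ S → RootedPart B₀ S A → k ℕ.+ count A ≡ count S →
              B ≗ B₀ ∪ₛ A → Run G B run → Completes B₀ S (blocksFrom G k run)
  completes {B₀ = B₀} {S = S} {B = B} ℕ.zero run _ part |A|≡|S| B≗ R =
    inj₂ (resumes B run B≗B₀∪S R refl)
    where
    open RootedPart part
    B≗B₀∪S : B ≗ B₀ ∪ₛ S
    B≗B₀∪S x = trans (B≗ x) (cong (B₀ x ∨_) (⊆-antisym part-⊆ (⊆-count-≡⇒⊇ part-⊆ |A|≡|S|) x))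
  completes (ℕ.suc k) [] _ _ _ _ _ = inj₁ refl
  completes {B₀ = B₀} {S = S} {A = A} (ℕ.suc k) ((S′ , e) ∷ run) minS part k+1+|A|≡|S| B≗
            (_ , minS′ , S′e , e-hangs , R) =
    completes k run minS part′ k+|A′|≡|S| (addEdge-∪ e B≗) R
    where
    open RootedPart part
    missing : ∃[ x ] S x ≡ true × A x ≡ false
    missing = ⊆-count-<⇒∃∖ part-⊆
      (subst (count A ℕ.<_) k+1+|A|≡|S| (ℕₚ.m<n+m (count A) (ℕ.s≤s ℕ.z≤n)))
    Se : S e ≡ true
    Se = next-edge-in-chosen minS part (proj₁ (proj₂ missing)) (proj₂ (proj₂ missing)) B≗ (proj₁ minS′) S′e
    B₀e∨Ae≡false : B₀ e ∨ A e ≡ false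
    B₀e∨Ae≡false = trans (sym (B≗ e)) (proj₁ (proj₁ (proj₁ minS′)) e S′e)
    part′ : RootedPart B₀ S (addEdge G A e)
    part′ = record
      { part-⊆ = λ x h → [ (λ { refl → Se }) , part-⊆ x ]′ (addEdge-elim {A = A} {e = e} {x = x} h)
      ; part-rooted = rooted-addEdge part-rooted (∨-conicalˡ _ _ B₀e∨Ae≡false) (VertexIn-mono (≗⇒⊆ B≗) e-hangs)
      ; part-inhabited = e , addEdge-self e
      }
    k+|A′|≡|S| : k ℕ.+ count (addEdge G A e) ≡ count S
    k+|A′|≡|S| = trans (cong (k ℕ.+_) (count-addEdge {A = A} (∨-conicalʳ _ _ B₀e∨Ae≡false)))
                       (trans (ℕₚ.+-suc k (count A)) k+1+|A|≡|S|)

  run-completes-chosen : ∀ {B S e run} → Run G B ((S , e) ∷ run) →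
                         Completes B S (blocksFrom G (count S ℕ.∸ 1) run)
  run-completes-chosen {B} {S} {e} {run} (_ , minS@((rS , _) , _) , Se , e-hangs , R) =
    completes (count S ℕ.∸ 1) run minS part k+|A₀|≡|S| (addEdge-∪ e (λ x → sym (∨-identityʳ (B x)))) R
    where
    A₀ : EdgeSet G
    A₀ = addEdge G (∅ G) e
    part : RootedPart B S A₀
    part = record
      { part-⊆ = λ x h → [ (λ { refl → Se }) , (λ ()) ]′ (addEdge-elim {A = ∅ G} {e = e} {x = x} h)
      ; part-rooted = rooted-addEdge rooted-∅ (proj₁ rS e Se) (VertexIn-mono (∪-⊆ˡ B (∅ G)) e-hangs)
      ; part-inhabited = e , addEdge-self e
      }
    0<|S| : 0 ℕ.< count S
    0<|S| = subst (ℕ._< count S) (count-∅ {n G}) (count-< {A = ∅ G} (λ _ ()) Se refl)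
    |A₀|≡1 : count A₀ ≡ 1
    |A₀|≡1 = trans (count-addEdge {A = ∅ G} {e} refl) (cong ℕ.suc (count-∅ {n G}))
    k+|A₀|≡|S| : (count S ℕ.∸ 1) ℕ.+ count A₀ ≡ count S
    k+|A₀|≡|S| = trans (cong ((count S ℕ.∸ 1) ℕ.+_) |A₀|≡1) (ℕₚ.m∸n+n≡m 0<|S|)

  greedy-bound : RemaindersAtLeast B δ → DensityAtMost B δ → ∀ run → Run G B run →
                 ∀ Ts → blocks G run ≡ Ts → RootedIn G (∅ G) T → (j : Fin (length Ts)) →
                 let d = dens G (lookup Ts j) in
                 surplus d T ≤ surplus d B + ΣL (surplus d) (take (toℕ j) Ts)
  greedy-bound _ _ [] _ .[] refl _ ()
  greedy-bound {B = B} {δ = δ} {T = T} remainders atMost ((S , e) ∷ run) (_ , (maxS , _) , Se , _)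
               .(S ∷ _) refl rT zero =
    subst (surplus (dens G S) T ≤_) (sym (+-identityʳ (surplus (dens G S) B)))
          (next-block-bound {δ = δ} remainders maxS (chosen-dens≤ {δ = δ} atMost maxS Se) rT)
  greedy-bound {B = B} {δ = δ} {T = T} remainders atMost ((S , e) ∷ run) R@(_ , (maxS@(rS , _) , _) , Se , _)
               .(S ∷ _) refl rT (suc j) with run-completes-chosen R
  ... | inj₁ no-blocks = ⊥-elim (Finₚ.¬Fin0 (subst (Fin ∘ length) no-blocks j))
  ... | inj₂ (resumes B′ run′ B′≗ R′ blocks≡) = begin
    surplus d T
      ≤⟨ greedy-bound {δ = dens G S} remainders′ atMost′ run′ R′ Ts (sym blocks≡) rT j ⟩
    surplus d B′ + Σ                 ≡⟨ cong (_+ Σ) (surplus-partition d (Disjoint-sym (proj₁ rS) , B′≗)) ⟩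
    surplus d B + surplus d S + Σ    ≡⟨ +-assoc (surplus d B) (surplus d S) Σ ⟩
    surplus d B + (surplus d S + Σ)  ∎
    where
    open ≤-Reasoning
    Ts : List (EdgeSet G)
    Ts = blocksFrom G (count S ℕ.∸ 1) run
    d : ℚ
    d = dens G (lookup Ts j)
    Σ : ℚ
    Σ = ΣL (surplus d) (take (toℕ j) Ts)
    remainders′ : RemaindersAtLeast B′ (dens G S)
    remainders′ = remainders-step {δ = δ} remainders maxS (chosen-dens≤ {δ = δ} atMost maxS Se) B′≗
    atMost′ : DensityAtMost B′ (dens G S)
    atMost′ = densityAtMost-step maxS B′≗

  greedy-bound-from-root : ∀ run → Run G (∅ G) run → RootedIn G (∅ G) T → (j : Fin (length (blocks G run))) →
                           let d = dens G (lookup (blocks G run) j) in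
                           surplus d T ≤ ΣL (surplus d) (take (toℕ j) (blocks G run))
  greedy-bound-from-root [] _ _ ()
  greedy-bound-from-root {T = T} run@((S , _) ∷ _) R@(_ , (maxS , _) , _) rT j =
    subst (surplus d T ≤_) (trans (cong (_+ Σ) (surplus-∅ d (λ _ → refl))) (+-identityˡ Σ))
          (greedy-bound {δ = dens G S} nothing-left (λ _ → maxDens⇒surplus≤0 maxS) run R _ refl rT j)
    where
    d : ℚ
    d = dens G (lookup (blocks G run) j)
    Σ : ℚ
    Σ = ΣL (surplus d) (take (toℕ j) (blocks G run))
    nothing-left : RemaindersAtLeast (∅ G) (dens G S)
    nothing-left _ _ = ≤-reflexive (sym (surplus-∅ (dens G S) (λ _ → refl)))

  ΣL-surplus : ∀ δ Ts → ΣL (surplus δ) Ts ≡ ΣL (λ Tᵢ → dens G Tᵢ * c Tᵢ) Ts - δ * ΣL c Ts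
  ΣL-surplus δ [] = sym (p-q*0≡p 0ℚ δ)
  ΣL-surplus δ (Tᵢ ∷ Ts) =
    trans (cong₂ _+_ (cong (_- δ * c Tᵢ) (sym (dens-*-c Tᵢ))) (ΣL-surplus δ Ts))
          (sym ([a+b]-d[x+y]≡[a-dx]+[b-dy] (dens G Tᵢ * c Tᵢ) _ (c Tᵢ) (ΣL c Ts) δ))

  surplus-bound⇒prize-bound : ∀ δ Ts → surplus δ T ≤ ΣL (surplus δ) Ts →
                              p T ≤ ΣL (λ Tᵢ → dens G Tᵢ * c Tᵢ) Ts + δ * (c T - ΣL c Ts)
  surplus-bound⇒prize-bound {T = T} δ Ts sT≤ = begin
    p T                      ≡⟨ p-q+q≡p (p T) (δ * c T) ⟨
    surplus δ T + δ * c T    ≤⟨ +-monoˡ-≤ (δ * c T) sT≤ ⟩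
    ΣL (surplus δ) Ts + δ * c T  ≡⟨ cong (_+ δ * c T) (ΣL-surplus δ Ts) ⟩
    Π - δ * Γ + δ * c T
      ≡⟨ solve 4 (λ a b y d → a :- d :* b :+ d :* y := a :+ d :* (y :- b)) refl Π Γ (c T) δ ⟩
    Π + δ * (c T - Γ)        ∎
    where
    open ≤-Reasoning
    Π : ℚ
    Π = ΣL (λ Tᵢ → dens G Tᵢ * c Tᵢ) Ts
    Γ : ℚ
    Γ = ΣL c Ts

lemma12 : (G : Tree) → IsTree G →
    (∀ e → 0ℚ < cost G e) →
    (∀ v → 0ℚ ≤ prize G v) →
    prize G zero ≡ 0ℚ →
    (run : List (Step G)) → Run G (∅ G) run →
    (T : EdgeSet G) → RootedIn G (∅ G) T →
    (j : Fin (length (blocks G run))) →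
    prizeRooted G T ≤
    (ΣL (λ Ti → dens G Ti * costOf G Ti) (take (toℕ j) (blocks G run))
    + dens G (lookup (blocks G run) j)
    * (costOf G T - ΣL (costOf G) (take (toℕ j) (blocks G run))))
lemma12 G _ cost-pos _ root-prize run R T rT j =
  ≤-trans (≤-reflexive (trans (cong (_+ p T) root-prize) (+-identityˡ (p T))))
          (surplus-bound⇒prize-bound d (take (toℕ j) (blocks G run)) (greedy-bound-from-root run R rT j))
  where
  open Greedy G cost-pos
  d : ℚ
  d = dens G (lookup (blocks G run) j)
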